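{- Let $\ell$ be a nonnegative integer. Let $a_0=1$ and, for $n\ge1$, $a_n=\chi_{P_n}(1,\ell)$ and $b_n=\chi_{C_n}(1,\ell)$. Then, for all integers $n,r,s,t$ for which every subscript appearing is nonnegative (and every subscript of $b$ is at least $1$), \begin{align*} b_n &= \ell a_{n-1}+\ell^2 a_{n-3},\\ b_n &= a_{n}-\ell^2 a_{n-4},\\ a_{r+s} &= \ell a_ra_{s-1}+\ell^2a_{r-1}a_{s-2},\\ a_{r+s} &= a_ra_s-\ell^2a_{r-2}a_{s-2},\\ a_{r+s+t+1} &= \ell a_ra_sa_t + \ell^3a_{r-1}a_{s-1}a_{t-1}-\ell^4a_{r-2}a_{s-2}a_{t-2}. \end{align*}
   Context: For nonnegative integers $k,\ell$, a $(k,\ell)$-coloring of a graph $G$ with vertex set $V$ is a map $\varphi: V\to\{c_1,\dots,c_{k+\ell}\}$; the colors $c_{k+1},\dots,c_{k+\ell}$ are wildcards. It is proper if whenever vertices $i,j$ are adjacent (including $i=j$ via a loop) and $\varphi(i),\varphi(j)\in\{c_1,\dots,c_k\}$, then $\varphi(i)\ne\varphi(j)$. $\chi_G(k,\ell)$ is the number of proper $(k,\ell)$-colorings of $G$. $P_n$ is the path graph on $n$ vertices and $C_n$ the cycle graph on $n$ vertices, where $C_1$ is a single vertex with a loop and $C_2$ is two vertices joined by two parallel edges. (With $k=1$ one has $a_n=\ell a_{n-1}+\ell a_{n-2}$ and $b_n=\ell b_{n-1}+\ell b_{n-2}$.) -}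

module Defs where

open import Data.Nat using (ℕ; zero; suc; _+_; _<_; _<?_)
open import Data.Nat.Properties using ()
open import Data.Fin using (Fin; toℕ; fromℕ) renaming (zero to fzero; suc to fsuc)
open import Data.Fin.Properties using () renaming (_≟_ to _≟ᶠ_)
open import Data.Vec using (Vec; []; _∷_; lookup)
open import Data.List using (List; []; _∷_; [_]; _++_; map; concatMap; length; filter; allFin)
open import Data.List.Relation.Unary.All using (All; all?)
open import Data.Product using (_×_; _,_; proj₁; proj₂)
open import Relation.Binary.PropositionalEquality using (_≡_)
open import Relation.Nullary using (¬_; Dec; ¬?)
open import Relation.Nullary.Decidable using (_→-dec_)

-- A (multi)graph on vertex set Fin n, given by its list of edges.
-- Loops are edges (i , i); parallel edges are repeated entries.
record Graph : Set where
  constructor graph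
  field
    size  : ℕ
    edges : List (Fin size × Fin size)
open Graph public

-- A (k,ℓ)-coloring: colour with index c (0-based) is c_{c+1};
-- indices < k are proper colours, indices k … k+ℓ-1 are wildcards.
Coloring : (G : Graph) (k ℓ : ℕ) → Set
Coloring G k ℓ = Vec (Fin (k + ℓ)) (size G)

EdgeOK : ∀ {n m} (k : ℕ) (φ : Vec (Fin m) n) → Fin n × Fin n → Set
EdgeOK k φ (i , j) = toℕ (lookup φ i) < k → toℕ (lookup φ j) < k → ¬ (lookup φ i ≡ lookup φ j)

edgeOK? : ∀ {n m} (k : ℕ) (φ : Vec (Fin m) n) (e : Fin n × Fin n) → Dec (EdgeOK k φ e)
edgeOK? k φ (i , j) =
  (toℕ (lookup φ i) <? k) →-dec ((toℕ (lookup φ j) <? k) →-dec ¬? (lookup φ i ≟ᶠ lookup φ j))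

Proper : (G : Graph) (k ℓ : ℕ) → Coloring G k ℓ → Set
Proper G k ℓ φ = All (EdgeOK k φ) (edges G)

proper? : (G : Graph) (k ℓ : ℕ) (φ : Coloring G k ℓ) → Dec (Proper G k ℓ φ)
proper? G k ℓ φ = all? (edgeOK? k φ) (edges G)

allVecs : (m n : ℕ) → List (Vec (Fin m) n)
allVecs m zero    = [ [] ]
allVecs m (suc n) = concatMap (λ c → map (c ∷_) (allVecs m n)) (allFin m)

χ : Graph → ℕ → ℕ → ℕ
χ G k ℓ = length (filter (proper? G k ℓ) (allVecs (k + ℓ) (size G)))

-- Path P_n: edges {i, i+1} for 0 ≤ i < n-1.
pathEdges : (n : ℕ) → List (Fin n × Fin n)
pathEdges zero                = []
pathEdges (suc zero)          = []
pathEdges (suc (suc n))       =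
  (fzero , fsuc fzero) ∷ map (λ e → fsuc (proj₁ e) , fsuc (proj₂ e)) (pathEdges (suc n))

P : ℕ → Graph
P n = graph n (pathEdges n)

-- Cycle C_n (n ≥ 1): path edges plus the edge {n-1, 0}.
-- C_1 = one vertex with a loop; C_2 = two vertices joined by two parallel edges.
-- (C_0 is set to the empty graph; it is never used.)
cycleEdges : (n : ℕ) → List (Fin n × Fin n)
cycleEdges zero    = []
cycleEdges (suc n) = pathEdges (suc n) ++ [ (fromℕ n , fzero) ]

C : ℕ → Graph
C n = graph n (cycleEdges n)

a : (ℓ : ℕ) → ℕ → ℕ
a ℓ zero    = 1
a ℓ (suc n) = χ (P (suc n)) 1 ℓ

b : (ℓ : ℕ) → ℕ → ℕ
b ℓ n = χ (C n) 1 ℓ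

module Submission where

-- With k = 1 an edge is violated exactly when both its ends get the proper colour c₁, so properness
-- only sees which vertices receive c₁. Counting proper colourings of a path while remembering only
-- whether the vertices just before and after it get c₁ (`chains`), and splitting off the first
-- vertex, gives a two-state transfer recurrence. It yields a₀ = 1, a₁ = ℓ + 1 and
-- aₙ = ℓaₙ₋₂ + ℓaₙ₋₁, and, closing the path up into a cycle, bₙ = ℓaₙ₋₁ + ℓ²aₙ₋₃. The identities
-- for a use nothing but this recurrence: the addition formula follows by induction on r, moving one
-- unit from r to s at each step, and the remaining identities are ring manipulations of it.

open import Defs

module Counting where
  open import Data.Bool using (Bool; true; false; _∧_)
  open import Data.Bool.Properties using (∧-assoc)
  open import Data.Bool.ListAction using (and; all)
  open import Data.Fin using (Fin) renaming (zero to fzero; suc to fsuc)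
  open import Data.List using (List; []; _∷_; _++_; map; concatMap; length; filter; tabulate)
  open import Data.List.Properties using (map-∘)
  open import Data.List.Relation.Unary.All using (all?)
  open import Data.Nat using (ℕ; zero; suc; _+_; _*_)
  open import Data.Vec using (Vec; _∷_)
  open import Function using (_∘_)
  open import Relation.Nullary using (does)
  open import Relation.Unary using (Decidable)
  open import Relation.Binary.PropositionalEquality using (_≡_; refl; sym; trans; cong; cong₂; module ≡-Reasoning)

  private variable
    A B : Set

  count : (A → Bool) → List A → ℕ
  count p []       = 0
  count p (x ∷ xs) with p x
  ... | true  = suc (count p xs)
  ... | false = count p xs

  length-filter≡count : ∀ {P : A → Set} (P? : Decidable P) xs →
    length (filter P? xs) ≡ count (λ x → does (P? x)) xs
  length-filter≡count P? []       = refl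
  length-filter≡count P? (x ∷ xs) with does (P? x)
  ... | true  = cong suc (length-filter≡count P? xs)
  ... | false = length-filter≡count P? xs

  count-cong : ∀ {p q : A → Bool} → (∀ x → p x ≡ q x) → ∀ xs → count p xs ≡ count q xs
  count-cong {p = p} {q} p≗q []       = refl
  count-cong {p = p} {q} p≗q (x ∷ xs) with p x | q x | p≗q x
  ... | true  | .true  | refl = cong suc (count-cong p≗q xs)
  ... | false | .false | refl = count-cong p≗q xs

  count-false : ∀ (xs : List A) → count (λ _ → false) xs ≡ 0
  count-false []       = refl
  count-false (x ∷ xs) = count-false xs

  count-++ : ∀ (p : A → Bool) xs ys → count p (xs ++ ys) ≡ count p xs + count p ys
  count-++ p []       ys = refl
  count-++ p (x ∷ xs) ys with p x
  ... | true  = cong suc (count-++ p xs ys)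
  ... | false = count-++ p xs ys

  count-map : ∀ (p : B → Bool) (f : A → B) xs → count p (map f xs) ≡ count (λ x → p (f x)) xs
  count-map p f []       = refl
  count-map p f (x ∷ xs) with p (f x)
  ... | true  = cong suc (count-map p f xs)
  ... | false = count-map p f xs

  count-concatMap-tabulate : ∀ (p : B → Bool) (g : A → List B) {n k} (f : Fin n → A) →
    (∀ i → count p (g (f i)) ≡ k) → count p (concatMap g (tabulate f)) ≡ n * k
  count-concatMap-tabulate p g {zero}  f eq = refl
  count-concatMap-tabulate p g {suc n} f eq =
    trans (count-++ p (g (f fzero)) _) (cong₂ _+_ (eq fzero) (count-concatMap-tabulate p g (f ∘ fsuc) (eq ∘ fsuc)))

  all-++ : ∀ (p : A → Bool) xs ys → all p (xs ++ ys) ≡ all p xs ∧ all p ys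
  all-++ p []       ys = refl
  all-++ p (x ∷ xs) ys = trans (cong (p x ∧_) (all-++ p xs ys)) (sym (∧-assoc (p x) _ _))

  all-map : ∀ (p : B → Bool) (f : A → B) xs → all p (map f xs) ≡ all (λ x → p (f x)) xs
  all-map p f xs = cong and (sym (map-∘ xs))

  does-all? : ∀ {P : A → Set} (P? : Decidable P) xs → does (all? P? xs) ≡ all (λ x → does (P? x)) xs
  does-all? P? []       = refl
  does-all? P? (x ∷ xs) = cong (does (P? x) ∧_) (does-all? P? xs)

  countVecs : ∀ {m} n → (Vec (Fin m) n → Bool) → ℕ
  countVecs {m} n p = count p (allVecs m n)

  countVecs-cons : ∀ {ℓ} n (p : Vec (Fin (suc ℓ)) (suc n) → Bool) (q : Vec (Fin (suc ℓ)) n → Bool) →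
    (∀ i ψ → p (fsuc i ∷ ψ) ≡ q ψ) →
    countVecs (suc n) p ≡ countVecs n (λ ψ → p (fzero ∷ ψ)) + ℓ * countVecs n q
  countVecs-cons {ℓ} n p q p-wild = begin
      count p (map (fzero ∷_) vecs ++ concatMap (λ c → map (c ∷_) vecs) (tabulate fsuc))
    ≡⟨ count-++ p (map (fzero ∷_) vecs) _ ⟩
      count p (map (fzero ∷_) vecs) + count p (concatMap (λ c → map (c ∷_) vecs) (tabulate fsuc))
    ≡⟨ cong₂ _+_ (count-map p (fzero ∷_) vecs) (count-concatMap-tabulate p _ fsuc count-wild) ⟩
      countVecs n (λ ψ → p (fzero ∷ ψ)) + ℓ * countVecs n q ∎
    where
      open ≡-Reasoning
      vecs : List (Vec (Fin (suc ℓ)) n)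
      vecs = allVecs (suc ℓ) n
      count-wild : ∀ i → count p (map (fsuc i ∷_) vecs) ≡ countVecs n q
      count-wild i = trans (count-map p (fsuc i ∷_) vecs) (count-cong (p-wild i) vecs)


module PathsAndCycles where
  open Counting
  open import Data.Bool using (Bool; true; false; _∧_; not)
  open import Data.Bool.Properties using (∧-assoc; ∧-zeroʳ; ∧-identityʳ)
  open import Data.Bool.ListAction using (all)
  open import Data.Fin using (Fin; fromℕ) renaming (zero to fzero; suc to fsuc)
  open import Data.List using (_++_; [_]; map)
  open import Data.Nat using (ℕ; zero; suc; _+_; _*_)
  open import Data.Nat.Properties using (*-distribˡ-+; *-identityʳ; +-comm)
  open import Data.Product using (_×_; _,_)
  open import Data.Vec using (Vec; []; _∷_; lookup)
  open import Relation.Nullary using (does)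
  open import Relation.Binary.PropositionalEquality using (_≡_; refl; sym; trans; cong; cong₂; module ≡-Reasoning)

  isProper : ∀ {m} → Fin (suc m) → Bool
  isProper fzero    = true
  isProper (fsuc _) = false

  edgeOK?-isProper : ∀ {m n} (φ : Vec (Fin (suc m)) n) i j →
    does (edgeOK? 1 φ (i , j)) ≡ not (isProper (lookup φ i) ∧ isProper (lookup φ j))
  edgeOK?-isProper φ i j with lookup φ i | lookup φ j
  ... | fzero  | fzero  = refl
  ... | fzero  | fsuc _ = refl
  ... | fsuc _ | _      = refl

  -- chain p ψ q: the path coloured ψ is proper, and so are its edges to a vertex before it and a
  -- vertex after it, which get c₁ exactly when p, respectively q, holds.
  chain : ∀ {m n} → Bool → Vec (Fin (suc m)) n → Bool → Bool
  chain p []       q = not (p ∧ q)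
  chain p (c ∷ ψ) q = not (p ∧ isProper c) ∧ chain (isProper c) ψ q

  pathEdges-chain : ∀ {m n} (c : Fin (suc m)) (ψ : Vec (Fin (suc m)) n) q →
    all (λ e → does (edgeOK? 1 (c ∷ ψ) e)) (pathEdges (suc n)) ∧ not (isProper (lookup (c ∷ ψ) (fromℕ n)) ∧ q)
      ≡ chain (isProper c) ψ q
  pathEdges-chain c []      q = refl
  pathEdges-chain {n = suc n} c (d ∷ ψ) q = begin
      (okᶜ (fzero , fsuc fzero) ∧ all okᶜ (map shift (pathEdges (suc n)))) ∧ closing
    ≡⟨ ∧-assoc (okᶜ (fzero , fsuc fzero)) _ closing ⟩
      okᶜ (fzero , fsuc fzero) ∧ (all okᶜ (map shift (pathEdges (suc n))) ∧ closing)
    ≡⟨ cong₂ _∧_ (edgeOK?-isProper (c ∷ d ∷ ψ) fzero (fsuc fzero))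
                 (trans (cong (_∧ closing) (all-map okᶜ shift (pathEdges (suc n)))) (pathEdges-chain d ψ q)) ⟩
      chain (isProper c) (d ∷ ψ) q ∎
    where
      open ≡-Reasoning
      okᶜ : Fin (2 + n) × Fin (2 + n) → Bool
      okᶜ e = does (edgeOK? 1 (c ∷ d ∷ ψ) e)
      shift : Fin (suc n) × Fin (suc n) → Fin (2 + n) × Fin (2 + n)
      shift (i , j) = fsuc i , fsuc j
      closing : Bool
      closing = not (isProper (lookup (d ∷ ψ) (fromℕ n)) ∧ q)

  proper-path : ∀ {ℓ n} (φ : Vec (Fin (suc ℓ)) n) → does (proper? (P n) 1 ℓ φ) ≡ chain false φ false
  proper-path []      = refl
  proper-path {n = suc n} (c ∷ ψ) = begin
      does (proper? (P (suc n)) 1 _ (c ∷ ψ))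
    ≡⟨ does-all? (edgeOK? 1 (c ∷ ψ)) (pathEdges (suc n)) ⟩
      all okᶜ (pathEdges (suc n))
    ≡⟨ sym (∧-identityʳ _) ⟩
      all okᶜ (pathEdges (suc n)) ∧ true
    ≡⟨ cong (λ b → all okᶜ (pathEdges (suc n)) ∧ not b) (sym (∧-zeroʳ _)) ⟩
      all okᶜ (pathEdges (suc n)) ∧ not (isProper (lookup (c ∷ ψ) (fromℕ n)) ∧ false)
    ≡⟨ pathEdges-chain c ψ false ⟩
      chain false (c ∷ ψ) false ∎
    where
      open ≡-Reasoning
      okᶜ : Fin (suc n) × Fin (suc n) → Bool
      okᶜ e = does (edgeOK? 1 (c ∷ ψ) e)

  closedChain : ∀ {m n} → Vec (Fin (suc m)) (suc n) → Bool
  closedChain (c ∷ ψ) = chain (isProper c) ψ (isProper c)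

  proper-cycle : ∀ {ℓ n} (φ : Vec (Fin (suc ℓ)) (suc n)) → does (proper? (C (suc n)) 1 ℓ φ) ≡ closedChain φ
  proper-cycle {n = n} (c ∷ ψ) = begin
      does (proper? (C (suc n)) 1 _ (c ∷ ψ))
    ≡⟨ does-all? (edgeOK? 1 (c ∷ ψ)) (cycleEdges (suc n)) ⟩
      all okᶜ (pathEdges (suc n) ++ [ fromℕ n , fzero ])
    ≡⟨ all-++ okᶜ (pathEdges (suc n)) _ ⟩
      all okᶜ (pathEdges (suc n)) ∧ (okᶜ (fromℕ n , fzero) ∧ true)
    ≡⟨ cong (all okᶜ (pathEdges (suc n)) ∧_) (trans (∧-identityʳ _) (edgeOK?-isProper (c ∷ ψ) (fromℕ n) fzero)) ⟩
      all okᶜ (pathEdges (suc n)) ∧ not (isProper (lookup (c ∷ ψ) (fromℕ n)) ∧ isProper c)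
    ≡⟨ pathEdges-chain c ψ (isProper c) ⟩
      closedChain (c ∷ ψ) ∎
    where
      open ≡-Reasoning
      okᶜ : Fin (suc n) × Fin (suc n) → Bool
      okᶜ e = does (edgeOK? 1 (c ∷ ψ) e)

  module _ (ℓ : ℕ) where
    open ≡-Reasoning

    chains : ℕ → Bool → Bool → ℕ
    chains n p q = countVecs n (λ (ψ : Vec (Fin (suc ℓ)) n) → chain p ψ q)

    chains-true : ∀ n q → chains (suc n) true q ≡ ℓ * chains n false q
    chains-true n q = begin
        chains (suc n) true q
      ≡⟨ countVecs-cons n (λ ψ → chain true ψ q) (λ ψ → chain false ψ q) (λ _ _ → refl) ⟩
        count (λ _ → false) (allVecs (suc ℓ) n) + ℓ * chains n false q
      ≡⟨ cong (_+ ℓ * chains n false q) (count-false (allVecs (suc ℓ) n)) ⟩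
        ℓ * chains n false q ∎

    chains-false : ∀ n q → chains (suc n) false q ≡ chains n true q + ℓ * chains n false q
    chains-false n q = countVecs-cons n (λ ψ → chain false ψ q) (λ ψ → chain false ψ q) (λ _ _ → refl)

    a≡chains : ∀ n → a ℓ n ≡ chains n false false
    a≡chains zero    = refl
    a≡chains (suc n) =
      trans (length-filter≡count (proper? (P (suc n)) 1 ℓ) (allVecs (suc ℓ) (suc n)))
            (count-cong proper-path (allVecs (suc ℓ) (suc n)))

    b≡chains : ∀ n → b ℓ (suc n) ≡ chains n true true + ℓ * a ℓ n
    b≡chains n = begin
        b ℓ (suc n)
      ≡⟨ length-filter≡count (proper? (C (suc n)) 1 ℓ) (allVecs (suc ℓ) (suc n)) ⟩
        count (λ φ → does (proper? (C (suc n)) 1 ℓ φ)) (allVecs (suc ℓ) (suc n))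
      ≡⟨ count-cong proper-cycle (allVecs (suc ℓ) (suc n)) ⟩
        countVecs (suc n) closedChain
      ≡⟨ countVecs-cons n closedChain (λ ψ → chain false ψ false) (λ _ _ → refl) ⟩
        chains n true true + ℓ * chains n false false
      ≡⟨ cong (λ k → chains n true true + ℓ * k) (sym (a≡chains n)) ⟩
        chains n true true + ℓ * a ℓ n ∎

    a-one : a ℓ 1 ≡ suc ℓ
    a-one = trans (a≡chains 1) (trans (chains-false 0 false) (cong suc (*-identityʳ ℓ)))

    a-rec : ∀ n → a ℓ (suc (suc n)) ≡ ℓ * a ℓ n + ℓ * a ℓ (suc n)
    a-rec n = begin
        a ℓ (suc (suc n))
      ≡⟨ a≡chains (suc (suc n)) ⟩
        chains (suc (suc n)) false false
      ≡⟨ chains-false (suc n) false ⟩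
        chains (suc n) true false + ℓ * chains (suc n) false false
      ≡⟨ cong₂ (λ x y → x + ℓ * y) (chains-true n false) (sym (a≡chains (suc n))) ⟩
        ℓ * chains n false false + ℓ * a ℓ (suc n)
      ≡⟨ cong (λ x → ℓ * x + ℓ * a ℓ (suc n)) (sym (a≡chains n)) ⟩
        ℓ * a ℓ n + ℓ * a ℓ (suc n) ∎

    chains-false-true : ∀ n → chains (suc n) false true ≡ ℓ * a ℓ n
    chains-false-true zero          = chains-false 0 true
    chains-false-true (suc zero)    = begin
        chains 2 false true
      ≡⟨ chains-false 1 true ⟩
        chains 1 true true + ℓ * chains 1 false true
      ≡⟨ cong₂ (λ x y → x + ℓ * y) (chains-true 0 true) (chains-false 0 true) ⟩
        ℓ * 1 + ℓ * (ℓ * 1)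
      ≡⟨ cong (λ x → ℓ * 1 + ℓ * x) (*-identityʳ ℓ) ⟩
        ℓ * 1 + ℓ * ℓ
      ≡⟨ sym (*-distribˡ-+ ℓ 1 ℓ) ⟩
        ℓ * suc ℓ
      ≡⟨ cong (ℓ *_) (sym a-one) ⟩
        ℓ * a ℓ 1 ∎
    chains-false-true (suc (suc n)) = begin
        chains (3 + n) false true
      ≡⟨ chains-false (2 + n) true ⟩
        chains (2 + n) true true + ℓ * chains (2 + n) false true
      ≡⟨ cong₂ (λ x y → x + ℓ * y) (chains-true (suc n) true) (chains-false-true (suc n)) ⟩
        ℓ * chains (suc n) false true + ℓ * (ℓ * a ℓ (suc n))
      ≡⟨ cong (λ x → ℓ * x + ℓ * (ℓ * a ℓ (suc n))) (chains-false-true n) ⟩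
        ℓ * (ℓ * a ℓ n) + ℓ * (ℓ * a ℓ (suc n))
      ≡⟨ sym (*-distribˡ-+ ℓ (ℓ * a ℓ n) _) ⟩
        ℓ * (ℓ * a ℓ n + ℓ * a ℓ (suc n))
      ≡⟨ cong (ℓ *_) (sym (a-rec n)) ⟩
        ℓ * a ℓ (2 + n) ∎

    b-closed : ∀ n → b ℓ (3 + n) ≡ ℓ * a ℓ (2 + n) + ℓ * (ℓ * a ℓ n)
    b-closed n = begin
        b ℓ (3 + n)
      ≡⟨ b≡chains (2 + n) ⟩
        chains (2 + n) true true + ℓ * a ℓ (2 + n)
      ≡⟨ cong (_+ ℓ * a ℓ (2 + n)) (trans (chains-true (suc n) true) (cong (ℓ *_) (chains-false-true n))) ⟩
        ℓ * (ℓ * a ℓ n) + ℓ * a ℓ (2 + n)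
      ≡⟨ +-comm (ℓ * (ℓ * a ℓ n)) _ ⟩
        ℓ * a ℓ (2 + n) + ℓ * (ℓ * a ℓ n) ∎


open import Data.Nat as ℕ using (ℕ; zero; suc; _≤_; _∸_; z≤n; s≤s)
open import Data.Nat.Properties using (+-suc; +-assoc; +-comm; ≤-trans; n≤1+n)
open import Data.Integer using (ℤ; +_; 1ℤ; _+_; _-_; _*_; _^_)
open import Data.Integer.Properties using (pos-+; pos-*)
open import Data.Integer.Tactic.RingSolver using (solve-∀)
open import Data.Product using (_×_; _,_)
open import Relation.Binary.PropositionalEquality using (_≡_; refl; sym; trans; cong; cong₂; module ≡-Reasoning)
open import Function using (_∘_)

module TwoTermRecurrence (L : ℤ) (f : ℕ → ℤ)
  (f-zero : f 0 ≡ 1ℤ) (f-one : f 1 ≡ 1ℤ + L)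
  (f-rec : ∀ n → f (suc (suc n)) ≡ L * f n + L * f (suc n)) where
  open ≡-Reasoning

  -- The ring solver does not recognise Data.Integer._^_, so the `identity` lemmas below spell
  -- L ^ k out as the product it unfolds to.

  addition-formula : ∀ r s → 1 ≤ r → 2 ≤ s →
    f (r ℕ.+ s) ≡ L * f r * f (s ∸ 1) + L ^ 2 * f (r ∸ 1) * f (s ∸ 2)
  addition-formula (suc zero) (suc (suc k)) (s≤s z≤n) (s≤s (s≤s z≤n)) = begin
      f (3 ℕ.+ k)
    ≡⟨ f-rec (suc k) ⟩
      L * f (suc k) + L * f (2 ℕ.+ k)
    ≡⟨ cong (λ x → L * f (suc k) + L * x) (f-rec k) ⟩
      L * f (suc k) + L * (L * f k + L * f (suc k))
    ≡⟨ identity L (f k) (f (suc k)) ⟩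
      L * (1ℤ + L) * f (suc k) + L ^ 2 * 1ℤ * f k
    ≡⟨ sym (cong₂ (λ x y → L * x * f (suc k) + L ^ 2 * y * f k) f-one f-zero) ⟩
      L * f 1 * f (suc k) + L ^ 2 * f 0 * f k ∎
    where
      identity : ∀ l x y → l * y + l * (l * x + l * y) ≡ l * (1ℤ + l) * y + (l * (l * 1ℤ)) * 1ℤ * x
      identity = solve-∀
  addition-formula (suc (suc m)) (suc (suc k)) (s≤s z≤n) (s≤s (s≤s z≤n)) = begin
      f (suc (suc m) ℕ.+ suc (suc k))
    ≡⟨ cong (f ∘ suc) (sym (+-suc m (suc (suc k)))) ⟩
      f (suc m ℕ.+ suc (suc (suc k)))
    ≡⟨ addition-formula (suc m) (suc (suc (suc k))) (s≤s z≤n) (s≤s (s≤s z≤n)) ⟩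
      L * f (suc m) * f (2 ℕ.+ k) + L ^ 2 * f m * f (suc k)
    ≡⟨ cong (λ x → L * f (suc m) * x + L ^ 2 * f m * f (suc k)) (f-rec k) ⟩
      L * f (suc m) * (L * f k + L * f (suc k)) + L ^ 2 * f m * f (suc k)
    ≡⟨ identity L (f m) (f (suc m)) (f k) (f (suc k)) ⟩
      L * (L * f m + L * f (suc m)) * f (suc k) + L ^ 2 * f (suc m) * f k
    ≡⟨ cong (λ x → L * x * f (suc k) + L ^ 2 * f (suc m) * f k) (sym (f-rec m)) ⟩
      L * f (2 ℕ.+ m) * f (suc k) + L ^ 2 * f (suc m) * f k ∎
    where
      identity : ∀ l x₀ x₁ y₀ y₁ →
        l * x₁ * (l * y₀ + l * y₁) + (l * (l * 1ℤ)) * x₀ * y₁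
          ≡ l * (l * x₀ + l * x₁) * y₁ + (l * (l * 1ℤ)) * x₁ * y₀
      identity = solve-∀

  product-formula : ∀ r s → 2 ≤ r → 2 ≤ s →
    f (r ℕ.+ s) ≡ f r * f s - L ^ 2 * f (r ∸ 2) * f (s ∸ 2)
  product-formula (suc (suc m)) (suc (suc k)) (s≤s (s≤s z≤n)) (s≤s (s≤s z≤n)) = begin
      f (2 ℕ.+ m ℕ.+ (2 ℕ.+ k))
    ≡⟨ addition-formula (2 ℕ.+ m) (2 ℕ.+ k) (s≤s z≤n) (s≤s (s≤s z≤n)) ⟩
      L * f (2 ℕ.+ m) * f (suc k) + L ^ 2 * f (suc m) * f k
    ≡⟨ cong (λ x → L * x * f (suc k) + L ^ 2 * f (suc m) * f k) (f-rec m) ⟩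
      L * (L * f m + L * f (suc m)) * f (suc k) + L ^ 2 * f (suc m) * f k
    ≡⟨ identity L (f m) (f (suc m)) (f k) (f (suc k)) ⟩
      (L * f m + L * f (suc m)) * (L * f k + L * f (suc k)) - L ^ 2 * f m * f k
    ≡⟨ sym (cong₂ (λ x y → x * y - L ^ 2 * f m * f k) (f-rec m) (f-rec k)) ⟩
      f (2 ℕ.+ m) * f (2 ℕ.+ k) - L ^ 2 * f m * f k ∎
    where
      identity : ∀ l x₀ x₁ y₀ y₁ →
        l * (l * x₀ + l * x₁) * y₁ + (l * (l * 1ℤ)) * x₁ * y₀
          ≡ (l * x₀ + l * x₁) * (l * y₀ + l * y₁) - (l * (l * 1ℤ)) * x₀ * y₀
      identity = solve-∀

  triple-formula : ∀ r s t → 2 ≤ r → 2 ≤ s → 2 ≤ t →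
    f (r ℕ.+ s ℕ.+ t ℕ.+ 1)
      ≡ L * f r * f s * f t + L ^ 3 * f (r ∸ 1) * f (s ∸ 1) * f (t ∸ 1)
        - L ^ 4 * f (r ∸ 2) * f (s ∸ 2) * f (t ∸ 2)
  triple-formula r@(suc (suc m)) s@(suc (suc p)) t@(suc (suc q))
                 (s≤s (s≤s z≤n)) (s≤s (s≤s z≤n)) (s≤s (s≤s z≤n)) = begin
      f (r ℕ.+ s ℕ.+ t ℕ.+ 1)
    ≡⟨ cong f (reassociate r s t) ⟩
      f (r ℕ.+ (s ℕ.+ suc t))
    ≡⟨ product-formula r (s ℕ.+ suc t) (s≤s (s≤s z≤n)) (s≤s (s≤s z≤n)) ⟩
      f r * f (s ℕ.+ suc t) - L ^ 2 * f m * f (p ℕ.+ suc t)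
    ≡⟨ cong₂ (λ x y → f r * x - L ^ 2 * f m * y)
             (addition-formula s (suc t) (s≤s z≤n) (s≤s (s≤s z≤n)))
             (trans (cong f (+-suc p t)) (addition-formula (suc p) t (s≤s z≤n) (s≤s (s≤s z≤n)))) ⟩
      f r * (L * f s * f t + L ^ 2 * f (suc p) * f (suc q))
        - L ^ 2 * f m * (L * f (suc p) * f (suc q) + L ^ 2 * f p * f q)
    ≡⟨ cong (λ x → x * (L * f s * f t + L ^ 2 * f (suc p) * f (suc q))
                     - L ^ 2 * f m * (L * f (suc p) * f (suc q) + L ^ 2 * f p * f q)) (f-rec m) ⟩
      (L * f m + L * f (suc m)) * (L * f s * f t + L ^ 2 * f (suc p) * f (suc q))
        - L ^ 2 * f m * (L * f (suc p) * f (suc q) + L ^ 2 * f p * f q)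
    ≡⟨ identity L (f m) (f (suc m)) (f p) (f (suc p)) (f s) (f q) (f (suc q)) (f t) ⟩
      L * (L * f m + L * f (suc m)) * f s * f t + L ^ 3 * f (suc m) * f (suc p) * f (suc q)
        - L ^ 4 * f m * f p * f q
    ≡⟨ cong (λ x → L * x * f s * f t + L ^ 3 * f (suc m) * f (suc p) * f (suc q) - L ^ 4 * f m * f p * f q)
            (sym (f-rec m)) ⟩
      L * f r * f s * f t + L ^ 3 * f (suc m) * f (suc p) * f (suc q) - L ^ 4 * f m * f p * f q ∎
    where
      reassociate : ∀ r s t → r ℕ.+ s ℕ.+ t ℕ.+ 1 ≡ r ℕ.+ (s ℕ.+ suc t)
      reassociate r s t = trans (+-assoc (r ℕ.+ s) t 1)
                                (trans (+-assoc r s (t ℕ.+ 1)) (cong (λ u → r ℕ.+ (s ℕ.+ u)) (+-comm t 1)))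
      identity : ∀ l x₀ x₁ y₀ y₁ y₂ z₀ z₁ z₂ →
        (l * x₀ + l * x₁) * (l * y₂ * z₂ + (l * (l * 1ℤ)) * y₁ * z₁)
          - (l * (l * 1ℤ)) * x₀ * (l * y₁ * z₁ + (l * (l * 1ℤ)) * y₀ * z₀)
        ≡ l * (l * x₀ + l * x₁) * y₂ * z₂ + (l * (l * (l * 1ℤ))) * x₁ * y₁ * z₁
          - (l * (l * (l * (l * 1ℤ)))) * x₀ * y₀ * z₀
      identity = solve-∀

  lagged-recurrence : ∀ n → 4 ≤ n → L * f (n ∸ 1) + L ^ 2 * f (n ∸ 3) ≡ f n - L ^ 2 * f (n ∸ 4)
  lagged-recurrence (suc (suc (suc (suc k)))) (s≤s (s≤s (s≤s (s≤s z≤n)))) = begin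
      L * f (3 ℕ.+ k) + L ^ 2 * f (suc k)
    ≡⟨ identity L (f k) (f (suc k)) (f (3 ℕ.+ k)) ⟩
      L * (L * f k + L * f (suc k)) + L * f (3 ℕ.+ k) - L ^ 2 * f k
    ≡⟨ cong (λ x → L * x + L * f (3 ℕ.+ k) - L ^ 2 * f k) (sym (f-rec k)) ⟩
      L * f (2 ℕ.+ k) + L * f (3 ℕ.+ k) - L ^ 2 * f k
    ≡⟨ cong (λ x → x - L ^ 2 * f k) (sym (f-rec (2 ℕ.+ k))) ⟩
      f (4 ℕ.+ k) - L ^ 2 * f k ∎
    where
      identity : ∀ l x₀ x₁ x₃ →
        l * x₃ + (l * (l * 1ℤ)) * x₁ ≡ l * (l * x₀ + l * x₁) + l * x₃ - (l * (l * 1ℤ)) * x₀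
      identity = solve-∀

open PathsAndCycles using (a-one; a-rec; b-closed)

a-rec-ℤ : ∀ ℓ n → + a ℓ (suc (suc n)) ≡ + ℓ * + a ℓ n + + ℓ * + a ℓ (suc n)
a-rec-ℤ ℓ n = trans (cong +_ (a-rec ℓ n))
  (trans (pos-+ (ℓ ℕ.* a ℓ n) _) (cong₂ _+_ (pos-* ℓ (a ℓ n)) (pos-* ℓ (a ℓ (suc n)))))

cycle-formula : ∀ ℓ n → 3 ≤ n → + b ℓ n ≡ + ℓ * + a ℓ (n ∸ 1) + (+ ℓ) ^ 2 * + a ℓ (n ∸ 3)
cycle-formula ℓ (suc (suc (suc k))) (s≤s (s≤s (s≤s z≤n))) = begin
    + b ℓ (3 ℕ.+ k)
  ≡⟨ cong +_ (b-closed ℓ k) ⟩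
    + (ℓ ℕ.* a ℓ (2 ℕ.+ k) ℕ.+ ℓ ℕ.* (ℓ ℕ.* a ℓ k))
  ≡⟨ trans (pos-+ (ℓ ℕ.* a ℓ (2 ℕ.+ k)) _)
           (cong₂ _+_ (pos-* ℓ _) (trans (pos-* ℓ (ℓ ℕ.* a ℓ k)) (cong (+ ℓ *_) (pos-* ℓ (a ℓ k))))) ⟩
    + ℓ * + a ℓ (2 ℕ.+ k) + + ℓ * (+ ℓ * + a ℓ k)
  ≡⟨ cong (λ x → + ℓ * + a ℓ (2 ℕ.+ k) + x) (square (+ ℓ) (+ a ℓ k)) ⟩
    + ℓ * + a ℓ (2 ℕ.+ k) + (+ ℓ) ^ 2 * + a ℓ k ∎
  where
    open ≡-Reasoning
    square : ∀ l x → l * (l * x) ≡ l * (l * 1ℤ) * x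
    square = solve-∀

theorem2p1 : (ℓ : ℕ) →
      (∀ n → 3 ≤ n →
        + b ℓ n ≡ + ℓ * + a ℓ (n ∸ 1) + (+ ℓ) ^ 2 * + a ℓ (n ∸ 3))
    × (∀ n → 4 ≤ n →
        + b ℓ n ≡ + a ℓ n - (+ ℓ) ^ 2 * + a ℓ (n ∸ 4))
    × (∀ r s → 1 ≤ r → 2 ≤ s →
        + a ℓ (r ℕ.+ s) ≡ + ℓ * + a ℓ r * + a ℓ (s ∸ 1) + (+ ℓ) ^ 2 * + a ℓ (r ∸ 1) * + a ℓ (s ∸ 2))
    × (∀ r s → 2 ≤ r → 2 ≤ s →
        + a ℓ (r ℕ.+ s) ≡ + a ℓ r * + a ℓ s - (+ ℓ) ^ 2 * + a ℓ (r ∸ 2) * + a ℓ (s ∸ 2))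
    × (∀ r s t → 2 ≤ r → 2 ≤ s → 2 ≤ t →
        + a ℓ (r ℕ.+ s ℕ.+ t ℕ.+ 1)
          ≡ + ℓ * + a ℓ r * + a ℓ s * + a ℓ t
            + (+ ℓ) ^ 3 * + a ℓ (r ∸ 1) * + a ℓ (s ∸ 1) * + a ℓ (t ∸ 1)
            - (+ ℓ) ^ 4 * + a ℓ (r ∸ 2) * + a ℓ (s ∸ 2) * + a ℓ (t ∸ 2))
theorem2p1 ℓ =
    cycle-formula ℓ
  , (λ n 4≤n → trans (cycle-formula ℓ n (≤-trans (n≤1+n 3) 4≤n)) (lagged-recurrence n 4≤n))
  , addition-formula
  , product-formula
  , triple-formula
  where
    open TwoTermRecurrence (+ ℓ) (λ n → + a ℓ n) refl (cong +_ (a-one ℓ)) (a-rec-ℤ ℓ)
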